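{- Let $\mathcal S_{fs}(p)$ be a monotonic fixed-size binary-tree source. Then the ordinal-tree source $\mathfrak S_{fcns}(\mathcal S_{fs}(p))$ is a monotonic fixed-size ordinal-tree source, i.e., there is a function $p'$ defining a fixed-size ordinal-tree source $\mathfrak S_{fs}(p')$ with $\mathbb P_{\mathfrak S_{fs}(p')}[t]=\mathbb P_{\mathfrak S_{fcns}(\mathcal S_{fs}(p))}[t]$ for all ordinal trees $t$, and $p'$ satisfies the three monotonicity conditions below.
   Context: Binary trees: ordered rooted trees with optional left/right children; $\Lambda$ the empty tree; $s_\ell[v],s_r[v]$ the subtrees at $v$'s left/right child; $|\cdot|$ number of nodes. A fixed-size binary source is $p:\mathbb N_0^2\to[0,1]$ with $\sum_{\ell=0}^np(\ell,n-\ell)=1$ for all $n$; it is monotonic if $p(\ell,r)\ge p(\ell+1,r)$ and $p(\ell,r)\ge p(\ell,r+1)$. Ordinal trees: rooted trees where each node has a (possibly empty) ordered sequence of children; a forest is a finite sequence of ordinal trees. The first-child-next-sibling map from forests to binary trees is $\mathrm{FCNS}(\varepsilon)=\Lambda$ and $\mathrm{FCNS}(t_1,\dots,t_j)=$ the binary tree whose root has left subtree $\mathrm{FCNS}(c_1,\dots,c_k)$ and right subtree $\mathrm{FCNS}(t_2,\dots,t_j)$, where $c_1,\dots,c_k$ are the root's children subtrees in $t_1$. The source $\mathfrak S_{fcns}(\mathcal S_{fs}(p))$ assigns to an ordinal tree $t$ with $n$ nodes the probability $\prod_{v\neq\rho}p(|s_\ell[v]|,|s_r[v]|)$, where $s=\mathrm{FCNS}(t)$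 and the product is over all nodes of $s$ except its root $\rho$. A fixed-size ordinal source $\mathfrak S_{fs}(p')$ is given by $p'$ on finite sequences of positive integers with $\sum_{k\ge0}\sum_{n_1+\dots+n_k=n-1,\,n_i\ge1}p'(n_1,\dots,n_k)=1$ for all $n\in\mathbb N$, and assigns $\mathbb P[t]=\prod_{v\in t}p'(|t_1[v]|,\dots,|t_{\deg(v)}[v]|)$, where $t_j[v]$ is the subtree of the $j$th child of $v$. It is monotonic if (i) $p'(n_1,\dots,n_i,\dots,n_k)\ge p'(n_1,\dots,n_i+1,\dots,n_k)$; (ii) $p'(n_1,\dots,n_i,n_{i+1},\dots,n_k)\ge p'(n_1,\dots,n_i,1,n_{i+1},\dots,n_k)$; (iii) $p'(n_1,\dots,n_k)\le p'(n_1,\dots,n_i)\cdot p'(n_{i+1},\dots,n_k)$, for all admissible arguments. -}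

module Defs where

open import Level using (Level; suc; _⊔_)
open import Data.Nat as ℕ using (ℕ; zero; _∸_)
open import Data.List using (List; []; _∷_; map; upTo; concatMap; foldr)
open import Relation.Binary.Core using (Rel)
open import Relation.Binary.Structures using (IsPreorder)
open import Algebra.Structures using (IsCommutativeSemiring)

-- Scalars: an ordered commutative semiring (ℝ with its usual order is
-- an instance).  Probabilities live in its carrier.

record OrderedCommSemiring (c ℓ₁ ℓ₂ : Level) : Set (suc (c ⊔ ℓ₁ ⊔ ℓ₂)) where
  infixl 7 _*_
  infixl 6 _+_
  infix 4 _≈_ _≤_
  field
    Carrier : Set c
    _≈_     : Rel Carrier ℓ₁
    _≤_     : Rel Carrier ℓ₂
    _+_     : Carrier → Carrier → Carrier
    _*_     : Carrier → Carrier → Carrier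
    0#      : Carrier
    1#      : Carrier
    isCommutativeSemiring : IsCommutativeSemiring _≈_ _+_ _*_ 0# 1#
    isPreorder : IsPreorder _≈_ _≤_
    0≤1     : 0# ≤ 1#
    +-mono-≤ : ∀ {a b c d} → a ≤ b → c ≤ d → a + c ≤ b + d
    *-mono-≤ : ∀ {a b c d} → 0# ≤ a → 0# ≤ c → a ≤ b → c ≤ d → a * c ≤ b * d

data BTree : Set where
  leaf : BTree
  bin  : BTree → BTree → BTree

bsize : BTree → ℕ
bsize leaf      = 0
bsize (bin l r) = ℕ.suc (bsize l ℕ.+ bsize r)

data OTree : Set where
  node : List OTree → OTree

mutual
  osize : OTree → ℕ
  osize (node cs) = ℕ.suc (fsize cs)

  fsize : List OTree → ℕ
  fsize []       = 0
  fsize (t ∷ ts) = osize t ℕ.+ fsize ts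

mutual
  childSizes : List OTree → List ℕ
  childSizes []       = []
  childSizes (t ∷ ts) = osize t ∷ childSizes ts

FCNS : List OTree → BTree
FCNS []               = leaf
FCNS (node cs ∷ ts)   = bin (FCNS cs) (FCNS ts)

-- Compositions of m: all sequences of positive integers summing to m.
-- Built structurally: every composition of m+1 arises uniquely from a
-- composition c of m either by prepending a part 1, or (if c is
-- nonempty) by increasing its first part by 1.

bumpFirst : List ℕ → List (List ℕ)
bumpFirst []       = []
bumpFirst (x ∷ xs) = (ℕ.suc x ∷ xs) ∷ []

compositions : ℕ → List (List ℕ)
compositions zero      = [] ∷ []
compositions (ℕ.suc m) = concatMap (λ c → (1 ∷ c) ∷ bumpFirst c) (compositions m)

module _ {c ℓ₁ ℓ₂ : Level} (R : OrderedCommSemiring c ℓ₁ ℓ₂) where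
  open OrderedCommSemiring R

  sumR : List Carrier → Carrier
  sumR = foldr _+_ 0#

  IsFixedSizeBinarySource : (ℕ → ℕ → Carrier) → Set (ℓ₁ ⊔ ℓ₂)
  IsFixedSizeBinarySource p =
    (∀ l r → (0# ≤ p l r) Data.Product.× (p l r ≤ 1#)) Data.Product.×
    (∀ n → sumR (map (λ l → p l (n ∸ l)) (upTo (ℕ.suc n))) ≈ 1#)
    where import Data.Product

  IsMonotonicBinary : (ℕ → ℕ → Carrier) → Set ℓ₂
  IsMonotonicBinary p =
    (∀ l r → p (ℕ.suc l) r ≤ p l r) Data.Product.× (∀ l r → p l (ℕ.suc r) ≤ p l r)
    where import Data.Product

  prodAll : (ℕ → ℕ → Carrier) → BTree → Carrier
  prodAll p leaf      = 1#
  prodAll p (bin l r) = p (bsize l) (bsize r) * (prodAll p l * prodAll p r)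

  prodNonRoot : (ℕ → ℕ → Carrier) → BTree → Carrier
  prodNonRoot p leaf      = 1#
  prodNonRoot p (bin l r) = prodAll p l * prodAll p r

  probFcns : (ℕ → ℕ → Carrier) → OTree → Carrier
  probFcns p t = prodNonRoot p (FCNS (t ∷ []))

  mutual
    probFs : (List ℕ → Carrier) → OTree → Carrier
    probFs p' (node cs) = p' (childSizes cs) * probFsForest p' cs

    probFsForest : (List ℕ → Carrier) → List OTree → Carrier
    probFsForest p' []       = 1#
    probFsForest p' (t ∷ ts) = probFs p' t * probFsForest p' ts

  Pos : List ℕ → Set
  Pos xs = Data.List.Relation.Unary.All.All (λ x → 1 ℕ.≤ x) xs
    where import Data.List.Relation.Unary.All

  -- fixed-size ordinal source p' (p' only matters on positive sequences)
  IsFixedSizeOrdinalSource : (List ℕ → Carrier) → Set (ℓ₁ ⊔ ℓ₂)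
  IsFixedSizeOrdinalSource p' =
    (∀ xs → Pos xs → (0# ≤ p' xs) Data.Product.× (p' xs ≤ 1#)) Data.Product.×
    -- for every n ≥ 1 (written n = m + 1): sum over all k and all
    -- n₁+…+n_k = n-1 with nᵢ ≥ 1 of p'(n₁,…,n_k) equals 1
    (∀ m → sumR (map p' (compositions m)) ≈ 1#)
    where import Data.Product

  -- monotonicity conditions (i)–(iii); a sequence n₁…n_k split at
  -- position i is written xs ++ ys with xs = n₁…nᵢ
  IsMonotonicOrdinal : (List ℕ → Carrier) → Set ℓ₂
  IsMonotonicOrdinal p' =
    (∀ xs n ys → Pos xs → 1 ℕ.≤ n → Pos ys →
        p' (xs ++ ℕ.suc n ∷ ys) ≤ p' (xs ++ n ∷ ys)) Data.Product.×
    (∀ xs ys → Pos xs → Pos ys →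
        p' (xs ++ 1 ∷ ys) ≤ p' (xs ++ ys)) Data.Product.×
    (∀ xs ys → Pos xs → Pos ys →
        p' (xs ++ ys) ≤ p' xs * p' ys)
    where import Data.Product
          open Data.List using (_++_)

-- A node with children of sizes n₁,…,n_k becomes, under FCNS, a chain of k
-- binary nodes: the i-th child is a binary node with n_i − 1 nodes on its left
-- (its own children) and n_{i+1}+⋯+n_k on its right (its later siblings).
-- Hence p'(n₁,…,n_k) = ∏ᵢ p(n_i − 1, n_{i+1}+⋯+n_k) reproduces the FCNS
-- probability.  Splitting a composition of m after its first part j + 1 writes
-- p' as p(j, m − j) times p' of a composition of m − j; by induction the latter
-- sum to 1, so p' sums to 1 over the compositions of m because p(j, m − j)
-- sums to 1 over j.  Monotonicity of p' holds factorwise: enlarging or inserting a part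
-- only enlarges the right arguments of the earlier factors, and cutting the
-- sequence after position i only shrinks them.
module Submission where

open import Defs
open import Level using (Level)
open import Data.Nat as ℕ using (ℕ; zero; suc; _∸_; s≤s; _≤′_; ≤′-refl; ≤′-step)
import Data.Nat.Properties as ℕ
open import Data.Nat.Induction using (<-rec)
open import Data.Nat.ListAction using (sum)
open import Data.Nat.ListAction.Properties using (sum-++)
open import Data.List using (List; []; _∷_; map; _++_; concatMap; upTo; applyUpTo)
open import Data.List.Relation.Unary.All using (All; []; _∷_)
open import Data.Product using (Σ; _×_; _,_; proj₁; proj₂)
open import Relation.Binary.PropositionalEquality as ≡ using (_≡_)
open import Relation.Binary.Structures using (IsPreorder)
open import Algebra.Bundles using (CommutativeSemiring)
import Algebra.Properties.CommutativeSemigroup as CommSemigroupProperties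
import Relation.Binary.Reasoning.Setoid as SetoidReasoning

sum-++-monoʳ : ∀ xs {ys ys'} → sum ys ℕ.≤ sum ys' → sum (xs ++ ys) ℕ.≤ sum (xs ++ ys')
sum-++-monoʳ []       ys≤ys' = ys≤ys'
sum-++-monoʳ (x ∷ xs) ys≤ys' = ℕ.+-monoʳ-≤ x (sum-++-monoʳ xs ys≤ys')

≤-sum-++ˡ : ∀ xs ys → sum xs ℕ.≤ sum (xs ++ ys)
≤-sum-++ˡ xs ys = ℕ.≤-trans (ℕ.m≤m+n (sum xs) (sum ys)) (ℕ.≤-reflexive (≡.sym (sum-++ xs ys)))

bsize-FCNS : ∀ ts → bsize (FCNS ts) ≡ fsize ts
bsize-FCNS []             = ≡.refl
bsize-FCNS (node cs ∷ ts) = ≡.cong₂ (λ a b → suc (a ℕ.+ b)) (bsize-FCNS cs) (bsize-FCNS ts)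

sum-childSizes : ∀ ts → sum (childSizes ts) ≡ fsize ts
sum-childSizes []       = ≡.refl
sum-childSizes (t ∷ ts) = ≡.cong (osize t ℕ.+_) (sum-childSizes ts)

module _ {c ℓ₁ ℓ₂ : Level} (R : OrderedCommSemiring c ℓ₁ ℓ₂) where
  open OrderedCommSemiring R using (_≤_; isPreorder; isCommutativeSemiring; 0≤1; *-mono-≤)

  commutativeSemiring : CommutativeSemiring c ℓ₁
  commutativeSemiring = record { isCommutativeSemiring = isCommutativeSemiring }

  open CommutativeSemiring commutativeSemiring
  open CommSemigroupProperties +-commutativeSemigroup using () renaming (interchange to +-interchange)
  open CommSemigroupProperties *-commutativeSemigroup using () renaming (interchange to *-interchange)
  open SetoidReasoning setoid

  sumR-map-cong : ∀ {A : Set} {P : A → Set} {F G : A → Carrier} xs →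
    All P xs → (∀ {x} → P x → F x ≈ G x) → sumR R (map F xs) ≈ sumR R (map G xs)
  sumR-map-cong [] [] _ = refl
  sumR-map-cong (x ∷ xs) (px ∷ pxs) F≈G = +-cong (F≈G px) (sumR-map-cong xs pxs F≈G)

  sumR-map-*-distribˡ : ∀ {A : Set} a (F : A → Carrier) xs →
    sumR R (map (λ x → a * F x) xs) ≈ a * sumR R (map F xs)
  sumR-map-*-distribˡ a F [] = sym (zeroʳ a)
  sumR-map-*-distribˡ a F (x ∷ xs) = begin
    a * F x + sumR R (map (λ x → a * F x) xs) ≈⟨ +-cong refl (sumR-map-*-distribˡ a F xs) ⟩
    a * F x + a * sumR R (map F xs)           ≈⟨ sym (distribˡ a (F x) _) ⟩
    a * (F x + sumR R (map F xs))             ∎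

  sumBelow : ℕ → (ℕ → Carrier) → Carrier
  sumBelow zero    g = 0#
  sumBelow (suc n) g = g 0 + sumBelow n (λ j → g (suc j))

  sumBelow-cong : ∀ n {f g : ℕ → Carrier} → (∀ j → f j ≈ g j) → sumBelow n f ≈ sumBelow n g
  sumBelow-cong zero    f≈g = refl
  sumBelow-cong (suc n) f≈g = +-cong (f≈g 0) (sumBelow-cong n (λ j → f≈g (suc j)))

  sumR-map-applyUpTo : ∀ (g : ℕ → Carrier) f n →
    sumR R (map g (applyUpTo f n)) ≡ sumBelow n (λ j → g (f j))
  sumR-map-applyUpTo g f zero    = ≡.refl
  sumR-map-applyUpTo g f (suc n) = ≡.cong (g (f 0) +_) (sumR-map-applyUpTo g (λ j → f (suc j)) n)

  compositionSum : ℕ → (List ℕ → Carrier) → Carrier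
  compositionSum m F = sumR R (map F (compositions m))

  all-compositions-sum : ∀ m → All (λ ns → sum ns ≡ m) (compositions m)
  all-compositions-sum zero    = ≡.refl ∷ []
  all-compositions-sum (suc m) = step (compositions m) (all-compositions-sum m)
    where
    step : ∀ L → All (λ ns → sum ns ≡ m) L →
      All (λ ns → sum ns ≡ suc m) (concatMap (λ ns → (1 ∷ ns) ∷ bumpFirst ns) L)
    step []              []         = []
    step ([] ∷ L)        (eq ∷ eqs) = ≡.cong suc eq ∷ step L eqs
    step ((n ∷ ns) ∷ L)  (eq ∷ eqs) = ≡.cong suc eq ∷ ≡.cong suc eq ∷ step L eqs

  bumpedFirst : (List ℕ → Carrier) → List ℕ → Carrier
  bumpedFirst F []       = 0#
  bumpedFirst F (n ∷ ns) = F (suc n ∷ ns)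

  compositionSum-suc : ∀ m F →
    compositionSum (suc m) F ≈ compositionSum m (λ ns → F (1 ∷ ns)) + compositionSum m (bumpedFirst F)
  compositionSum-suc m F = split (compositions m)
    where
    split : ∀ L → sumR R (map F (concatMap (λ ns → (1 ∷ ns) ∷ bumpFirst ns) L))
                ≈ sumR R (map (λ ns → F (1 ∷ ns)) L) + sumR R (map (bumpedFirst F) L)
    split []              = sym (+-identityʳ 0#)
    split ([] ∷ L)        = begin
      F (1 ∷ []) + _             ≈⟨ +-cong refl (split L) ⟩
      F (1 ∷ []) + (_ + _)       ≈⟨ sym (+-assoc _ _ _) ⟩
      (F (1 ∷ []) + _) + _       ≈⟨ +-cong refl (sym (+-identityˡ _)) ⟩
      (F (1 ∷ []) + _) + (0# + _) ∎
    split ((n ∷ ns) ∷ L) = begin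
      F (1 ∷ n ∷ ns) + (F (suc n ∷ ns) + _)       ≈⟨ +-cong refl (+-cong refl (split L)) ⟩
      F (1 ∷ n ∷ ns) + (F (suc n ∷ ns) + (_ + _)) ≈⟨ sym (+-assoc _ _ _) ⟩
      (F (1 ∷ n ∷ ns) + F (suc n ∷ ns)) + (_ + _) ≈⟨ +-interchange _ _ _ _ ⟩
      (F (1 ∷ n ∷ ns) + _) + (F (suc n ∷ ns) + _) ∎

  compositionSum-byFirstPart : ∀ m F → compositionSum (suc m) F ≈
    sumBelow (suc m) (λ j → compositionSum (m ∸ j) (λ ns → F (suc j ∷ ns)))
  compositionSum-byFirstPart zero    F = +-cong (sym (+-identityʳ _)) refl
  compositionSum-byFirstPart (suc m) F = begin
    compositionSum (suc (suc m)) F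
      ≈⟨ compositionSum-suc (suc m) F ⟩
    compositionSum (suc m) (λ ns → F (1 ∷ ns)) + compositionSum (suc m) (bumpedFirst F)
      ≈⟨ +-cong refl (compositionSum-byFirstPart m (bumpedFirst F)) ⟩
    sumBelow (suc (suc m)) (λ j → compositionSum (suc m ∸ j) (λ ns → F (suc j ∷ ns))) ∎

  ≤-reflexive : ∀ {a b} → a ≈ b → a ≤ b
  ≤-reflexive = IsPreorder.reflexive isPreorder

  ≤-trans : ∀ {a b d} → a ≤ b → b ≤ d → a ≤ d
  ≤-trans = IsPreorder.trans isPreorder

  0≤* : ∀ {a b} → 0# ≤ a → 0# ≤ b → 0# ≤ a * b
  0≤* 0≤a 0≤b = ≤-trans (≤-reflexive (sym (zeroʳ 0#))) (*-mono-≤ 0≤0 0≤0 0≤a 0≤b)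
    where
    0≤0 : 0# ≤ 0#
    0≤0 = ≤-reflexive refl

  *≤1 : ∀ {a b} → 0# ≤ a → 0# ≤ b → a ≤ 1# → b ≤ 1# → a * b ≤ 1#
  *≤1 0≤a 0≤b a≤1 b≤1 = ≤-trans (*-mono-≤ 0≤a 0≤b a≤1 b≤1) (≤-reflexive (*-identityʳ 1#))

  module _ (p : ℕ → ℕ → Carrier) where

    childrenWeight : List ℕ → Carrier
    childrenWeight []       = 1#
    childrenWeight (n ∷ ns) = p (n ∸ 1) (sum ns) * childrenWeight ns

    childrenWeight-FCNS : ∀ ts →
      childrenWeight (childSizes ts) * probFsForest R childrenWeight ts ≈ prodAll R p (FCNS ts)
    childrenWeight-FCNS []             = *-identityʳ 1#
    childrenWeight-FCNS (node cs ∷ ts) = begin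
      (p (fsize cs) (sum (childSizes ts)) * childrenWeight (childSizes ts)) *
        (probFs R childrenWeight (node cs) * probFsForest R childrenWeight ts)
        ≈⟨ *-interchange _ _ _ _ ⟩
      (p (fsize cs) (sum (childSizes ts)) * probFs R childrenWeight (node cs)) *
        (childrenWeight (childSizes ts) * probFsForest R childrenWeight ts)
        ≈⟨ *-assoc _ _ _ ⟩
      p (fsize cs) (sum (childSizes ts)) *
        (probFs R childrenWeight (node cs) * (childrenWeight (childSizes ts) * probFsForest R childrenWeight ts))
        ≈⟨ *-cong (reflexive (≡.cong₂ p (≡.sym (bsize-FCNS cs))
                                        (≡.trans (sum-childSizes ts) (≡.sym (bsize-FCNS ts)))))
                  (*-cong (childrenWeight-FCNS cs) (childrenWeight-FCNS ts)) ⟩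
      p (bsize (FCNS cs)) (bsize (FCNS ts)) * (prodAll R p (FCNS cs) * prodAll R p (FCNS ts)) ∎

    probFs-childrenWeight : ∀ t → probFs R childrenWeight t ≈ probFcns R p t
    probFs-childrenWeight (node cs) = trans (childrenWeight-FCNS cs) (sym (*-identityʳ _))

    compositionSum-childrenWeight :
      (∀ n → sumR R (map (λ l → p l (n ∸ l)) (upTo (suc n))) ≈ 1#) →
      ∀ m → compositionSum m childrenWeight ≈ 1#
    compositionSum-childrenWeight sumsToOne = <-rec _ go
      where
      go : ∀ m → (∀ {k} → k ℕ.< m → compositionSum k childrenWeight ≈ 1#) →
           compositionSum m childrenWeight ≈ 1#
      go zero    _  = +-identityʳ 1#
      go (suc m) ih = begin
        compositionSum (suc m) childrenWeight
          ≈⟨ compositionSum-byFirstPart m childrenWeight ⟩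
        sumBelow (suc m) (λ j → compositionSum (m ∸ j) (λ ns → childrenWeight (suc j ∷ ns)))
          ≈⟨ sumBelow-cong (suc m) firstPart ⟩
        sumBelow (suc m) (λ j → p j (m ∸ j))
          ≡⟨ ≡.sym (sumR-map-applyUpTo (λ j → p j (m ∸ j)) (λ j → j) (suc m)) ⟩
        sumR R (map (λ j → p j (m ∸ j)) (upTo (suc m)))
          ≈⟨ sumsToOne m ⟩
        1# ∎
        where
        firstPart : ∀ j → compositionSum (m ∸ j) (λ ns → childrenWeight (suc j ∷ ns)) ≈ p j (m ∸ j)
        firstPart j = begin
          compositionSum (m ∸ j) (λ ns → p j (sum ns) * childrenWeight ns)
            ≈⟨ sumR-map-cong (compositions (m ∸ j)) (all-compositions-sum (m ∸ j))
                             (λ eq → *-cong (reflexive (≡.cong (p j) eq)) refl) ⟩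
          compositionSum (m ∸ j) (λ ns → p j (m ∸ j) * childrenWeight ns)
            ≈⟨ sumR-map-*-distribˡ _ childrenWeight (compositions (m ∸ j)) ⟩
          p j (m ∸ j) * compositionSum (m ∸ j) childrenWeight
            ≈⟨ *-cong refl (ih (s≤s (ℕ.m∸n≤m m j))) ⟩
          p j (m ∸ j) * 1#
            ≈⟨ *-identityʳ _ ⟩
          p j (m ∸ j) ∎

    module _ (0≤p : ∀ l r → 0# ≤ p l r) where

      0≤childrenWeight : ∀ ns → 0# ≤ childrenWeight ns
      0≤childrenWeight []       = 0≤1
      0≤childrenWeight (n ∷ ns) = 0≤* (0≤p _ _) (0≤childrenWeight ns)

      childrenWeight≤1 : (∀ l r → p l r ≤ 1#) → ∀ ns → childrenWeight ns ≤ 1#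
      childrenWeight≤1 p≤1 []       = ≤-reflexive refl
      childrenWeight≤1 p≤1 (n ∷ ns) =
        *≤1 (0≤p _ _) (0≤childrenWeight ns) (p≤1 _ _) (childrenWeight≤1 p≤1 ns)

      module _ (p-antitoneˡ : ∀ l r → p (suc l) r ≤ p l r)
               (p-antitoneʳ-suc : ∀ l r → p l (suc r) ≤ p l r) where

        p-antitoneʳ : ∀ l {r r'} → r ℕ.≤ r' → p l r' ≤ p l r
        p-antitoneʳ l r≤r' = go (ℕ.≤⇒≤′ r≤r')
          where
          go : ∀ {r r'} → r ≤′ r' → p l r' ≤ p l r
          go ≤′-refl         = ≤-reflexive refl
          go (≤′-step r≤′r') = ≤-trans (p-antitoneʳ-suc l _) (go r≤′r')

        childrenWeight-++-monoʳ : ∀ xs {ys ys'} → sum ys ℕ.≤ sum ys' →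
          childrenWeight ys' ≤ childrenWeight ys → childrenWeight (xs ++ ys') ≤ childrenWeight (xs ++ ys)
        childrenWeight-++-monoʳ []       _       w≤w = w≤w
        childrenWeight-++-monoʳ (x ∷ xs) {ys' = ys'} sum≤sum w≤w =
          *-mono-≤ (0≤p _ _) (0≤childrenWeight (xs ++ ys'))
            (p-antitoneʳ (x ∸ 1) (sum-++-monoʳ xs sum≤sum))
            (childrenWeight-++-monoʳ xs sum≤sum w≤w)

        childrenWeight-suc-part : ∀ xs n ys → childrenWeight (xs ++ suc n ∷ ys) ≤ childrenWeight (xs ++ n ∷ ys)
        childrenWeight-suc-part xs n ys = childrenWeight-++-monoʳ xs (ℕ.n≤1+n _)
          (*-mono-≤ (0≤p _ _) (0≤childrenWeight ys) (firstFactor n) (≤-reflexive refl))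
          where
          firstFactor : ∀ n → p n (sum ys) ≤ p (n ∸ 1) (sum ys)
          firstFactor zero    = ≤-reflexive refl
          firstFactor (suc n) = p-antitoneˡ n (sum ys)

        childrenWeight-insert-1 : (∀ l r → p l r ≤ 1#) →
          ∀ xs ys → childrenWeight (xs ++ 1 ∷ ys) ≤ childrenWeight (xs ++ ys)
        childrenWeight-insert-1 p≤1 xs ys = childrenWeight-++-monoʳ xs (ℕ.n≤1+n _)
          (≤-trans (*-mono-≤ (0≤p _ _) (0≤childrenWeight ys) (p≤1 _ _) (≤-reflexive refl))
                   (≤-reflexive (*-identityˡ _)))

        childrenWeight-++ : ∀ xs ys → childrenWeight (xs ++ ys) ≤ childrenWeight xs * childrenWeight ys
        childrenWeight-++ []       ys = ≤-reflexive (sym (*-identityˡ _))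
        childrenWeight-++ (x ∷ xs) ys = ≤-trans
          (*-mono-≤ (0≤p _ _) (0≤childrenWeight (xs ++ ys))
            (p-antitoneʳ (x ∸ 1) (≤-sum-++ˡ xs ys))
            (childrenWeight-++ xs ys))
          (≤-reflexive (sym (*-assoc _ _ _)))

mainTheorem9 : {c ℓ₁ ℓ₂ : Level} (R : OrderedCommSemiring c ℓ₁ ℓ₂) →
    (p : ℕ → ℕ → OrderedCommSemiring.Carrier R) →
    IsFixedSizeBinarySource R p → IsMonotonicBinary R p →
    Σ (List ℕ → OrderedCommSemiring.Carrier R) (λ p' →
      IsFixedSizeOrdinalSource R p' ×
      ((t : OTree) → OrderedCommSemiring._≈_ R (probFs R p' t) (probFcns R p t)) ×
      IsMonotonicOrdinal R p')
mainTheorem9 R p (bounds , sumsToOne) (antitoneˡ , antitoneʳ) =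
  childrenWeight R p ,
  ((λ ns _ → 0≤childrenWeight R p 0≤p ns , childrenWeight≤1 R p 0≤p p≤1 ns) ,
   compositionSum-childrenWeight R p sumsToOne) ,
  probFs-childrenWeight R p ,
  ((λ xs n ys _ _ _ → childrenWeight-suc-part R p 0≤p antitoneˡ antitoneʳ xs n ys) ,
   (λ xs ys _ _ → childrenWeight-insert-1 R p 0≤p antitoneˡ antitoneʳ p≤1 xs ys) ,
   (λ xs ys _ _ → childrenWeight-++ R p 0≤p antitoneˡ antitoneʳ xs ys))
  where
  open OrderedCommSemiring R using (_≤_; 0#; 1#)

  0≤p : ∀ l r → 0# ≤ p l r
  0≤p l r = proj₁ (bounds l r)

  p≤1 : ∀ l r → p l r ≤ 1#
  p≤1 l r = proj₂ (bounds l r)
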